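{- Let $a,b,n$ be integers with $n\ge a+b$ and $2\le a\le b$. Then \[ \binom{n-1}{a-1}+\binom{n-1}{b-1}\le\binom{n}{b}-\binom{n-a+1}{b}+n-a+1. \]
   Context: Binomial coefficients $\binom{m}{j}$ are $0$ when $j<0$ or $j>m$. -}

module Defs where

-- Put d = n - a + 1, so that n = d + (a - 1). Pascal's rule telescopes
-- C(n, b) - C(d, b) into the column sum of C(d + l, b - 1) over l < a - 1, and
-- C(n - 1, a - 1) into d plus the diagonal sum of C(d + l, l + 2) over l < a - 2.
-- The last column term is C(n - 1, b - 1), so what remains is the termwise
-- comparison C(d + l, l + 2) ≤ C(d + l, b - 1). It holds by unimodality of the
-- rows of Pascal's triangle, since l + 2 ≤ b - 1 and (l + 2) + (b - 1) ≤ d + l.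
module Submission where

open import Defs
open import Data.Nat using (ℕ; _≤_; _+_; _∸_)
open import Data.Nat.Combinatorics using (_C_)
open import Data.Integer as ℤ using (ℤ; +_)

open import Data.Nat using (zero; suc; z≤n; s≤s; _<_; _≤?_)
open import Data.Nat.Properties
open import Data.Nat.Combinatorics
  using (nCk≡nC[n∸k]; nC1≡n; nCk+nC[k+1]≡[n+1]C[k+1])
open import Data.Nat.Tactic.RingSolver using (solve-∀)
import Data.Integer.Properties as ℤ
import Data.Integer.Tactic.RingSolver as ℤ
open import Relation.Nullary using (yes; no)
open import Relation.Binary.PropositionalEquality

sumBelow : (ℕ → ℕ) → ℕ → ℕ
sumBelow f zero    = 0
sumBelow f (suc k) = sumBelow f k + f k

sumBelow-mono-≤ : ∀ {f g} k → (∀ {l} → l < k → f l ≤ g l) → sumBelow f k ≤ sumBelow g k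
sumBelow-mono-≤ zero    f≤g = z≤n
sumBelow-mono-≤ (suc k) f≤g =
  +-mono-≤ (sumBelow-mono-≤ k (λ l<k → f≤g (m<n⇒m<1+n l<k))) (f≤g (n<1+n k))

pascal : ∀ n k → suc n C suc k ≡ n C k + n C suc k
pascal n k = sym (nCk+nC[k+1]≡[n+1]C[k+1] n k)

k≤n⇒nCk>0 : ∀ {n k} → k ≤ n → 0 < n C k
k≤n⇒nCk>0 {n}     {zero}  _         = s≤s z≤n
k≤n⇒nCk>0 {suc n} {suc k} (s≤s k≤n) rewrite pascal n k = ≤-trans (k≤n⇒nCk>0 k≤n) (m≤m+n _ _)

j+k≡n⇒nCj≡nCk : ∀ {n j k} → j + k ≡ n → n C j ≡ n C k
j+k≡n⇒nCj≡nCk {j = j} {k} refl =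
  trans (nCk≡nC[n∸k] (m≤m+n j k)) (cong ((j + k) C_) (m+n∸m≡n j k))

-- Pascal's rule reduces to the same statement one row up, except on the
-- line j + k = n, where the symmetry of the row closes the case.
j≤k⇒j+k≤n⇒nCj≤nCk : ∀ n {j k} → j ≤ k → j + k ≤ n → n C j ≤ n C k
j≤k⇒j+k≤n⇒nCj≤nCk n {zero} _ k≤n = k≤n⇒nCk>0 k≤n
j≤k⇒j+k≤n⇒nCj≤nCk (suc n) {suc j} {suc k} (s≤s j≤k) (s≤s j+1+k≤n) with suc j + suc k ≤? n
... | yes j+k<n rewrite pascal n j | pascal n k =
  +-mono-≤ (j≤k⇒j+k≤n⇒nCj≤nCk n j≤k (≤-trans (+-monoʳ-≤ j (n≤1+n k)) j+1+k≤n))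
           (j≤k⇒j+k≤n⇒nCj≤nCk n (s≤s j≤k) j+k<n)
... | no  j+k≮n =
  ≤-reflexive (j+k≡n⇒nCj≡nCk {j = suc j} {suc k}
    (≤-antisym (s≤s j+1+k≤n) (≮⇒≥ (λ j+k<n → j+k≮n (≤-pred j+k<n)))))

C-upper-telescope : ∀ d r m → (m + d) C suc r ≡ d C suc r + sumBelow (λ i → (i + d) C r) m
C-upper-telescope d r zero    = sym (+-identityʳ (d C suc r))
C-upper-telescope d r (suc m) = begin
  suc (m + d) C suc r
    ≡⟨ pascal (m + d) r ⟩
  (m + d) C r + (m + d) C suc r
    ≡⟨ cong (λ x → (m + d) C r + x) (C-upper-telescope d r m) ⟩
  (m + d) C r + (d C suc r + sumBelow (λ i → (i + d) C r) m)
    ≡⟨ x+[y+z]≡y+[z+x] ((m + d) C r) (d C suc r) _ ⟩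
  d C suc r + (sumBelow (λ i → (i + d) C r) m + (m + d) C r) ∎
  where
  open ≡-Reasoning
  x+[y+z]≡y+[z+x] : ∀ x y z → x + (y + z) ≡ y + (z + x)
  x+[y+z]≡y+[z+x] = solve-∀

C-diagonal-telescope : ∀ d k → (k + d) C suc k ≡ d + sumBelow (λ l → (l + d) C suc (suc l)) k
C-diagonal-telescope d zero    = trans (nC1≡n d) (sym (+-identityʳ d))
C-diagonal-telescope d (suc k) = begin
  suc (k + d) C suc (suc k)
    ≡⟨ pascal (k + d) (suc k) ⟩
  (k + d) C suc k + (k + d) C suc (suc k)
    ≡⟨ cong (_+ (k + d) C suc (suc k)) (C-diagonal-telescope d k) ⟩
  d + sumBelow (λ l → (l + d) C suc (suc l)) k + (k + d) C suc (suc k)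
    ≡⟨ +-assoc d _ _ ⟩
  d + (sumBelow (λ l → (l + d) C suc (suc l)) k + (k + d) C suc (suc k)) ∎
  where open ≡-Reasoning

-- The theorem for a = k + 2, with b + 1 in place of b, and n = suc k + d.
lemma5p2-shifted : ∀ k b d → suc k ≤ b → suc (suc b) ≤ d →
  (k + d) C suc k + (k + d) C b + d C suc b ≤ (suc k + d) C suc b + d
lemma5p2-shifted k b d k<b b+2≤d = begin
  (k + d) C suc k + (k + d) C b + d C suc b
    ≡⟨ cong (λ x → x + (k + d) C b + d C suc b) (C-diagonal-telescope d k) ⟩
  d + sumBelow (λ l → (l + d) C suc (suc l)) k + (k + d) C b + d C suc b
    ≤⟨ +-monoˡ-≤ _ (+-monoˡ-≤ _ (+-monoʳ-≤ d (sumBelow-mono-≤ k diagonal≤column))) ⟩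
  d + sumBelow (λ l → (l + d) C b) k + (k + d) C b + d C suc b
    ≡⟨ rearrange d _ _ _ ⟩
  d C suc b + (sumBelow (λ l → (l + d) C b) k + (k + d) C b) + d
    ≡⟨ cong (_+ d) (C-upper-telescope d b (suc k)) ⟨
  (suc k + d) C suc b + d ∎
  where
  open ≤-Reasoning
  diagonal≤column : ∀ {l} → l < k → (l + d) C suc (suc l) ≤ (l + d) C b
  diagonal≤column {l} l<k = j≤k⇒j+k≤n⇒nCj≤nCk (l + d)
    (≤-trans (s≤s l<k) k<b)
    (subst (_≤ l + d) (trans (+-suc l (suc b)) (cong suc (+-suc l b)))
      (+-monoʳ-≤ l b+2≤d))
  rearrange : ∀ d s x y → d + s + x + y ≡ y + (s + x) + d
  rearrange = solve-∀

m+n+o≤p+q⇒m+n≤p-o+q : ∀ {m n o p q} → m + n + o ≤ p + q →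
  + m ℤ.+ + n ℤ.≤ (+ p ℤ.- + o) ℤ.+ + q
m+n+o≤p+q⇒m+n≤p-o+q {m} {n} {o} {p} {q} h = begin
  + m ℤ.+ + n                       ≡⟨ x≡x+z-z (+ m ℤ.+ + n) (+ o) ⟩
  (+ m ℤ.+ + n ℤ.+ + o) ℤ.- + o      ≡⟨ cong (λ x → x ℤ.+ + o ℤ.- + o) (ℤ.pos-+ m n) ⟨
  (+ (m + n) ℤ.+ + o) ℤ.- + o        ≡⟨ cong (ℤ._- + o) (ℤ.pos-+ (m + n) o) ⟨
  + (m + n + o) ℤ.- + o              ≤⟨ ℤ.+-monoˡ-≤ (ℤ.- + o) (ℤ.+≤+ h) ⟩
  + (p + q) ℤ.- + o                  ≡⟨ cong (ℤ._- + o) (ℤ.pos-+ p q) ⟩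
  (+ p ℤ.+ + q) ℤ.- + o              ≡⟨ x+y-z≡x-z+y (+ p) (+ q) (+ o) ⟩
  (+ p ℤ.- + o) ℤ.+ + q ∎
  where
  open ℤ.≤-Reasoning
  x≡x+z-z : ∀ x z → x ≡ x ℤ.+ z ℤ.- z
  x≡x+z-z = ℤ.solve-∀
  x+y-z≡x-z+y : ∀ x y z → x ℤ.+ y ℤ.- z ≡ x ℤ.- z ℤ.+ y
  x+y-z≡x-z+y = ℤ.solve-∀

lemma5p2 : (a b n : ℕ) → 2 ≤ a → a ≤ b → a + b ≤ n →
    (+ ((n ∸ 1) C (a ∸ 1))) ℤ.+ (+ ((n ∸ 1) C (b ∸ 1)))
      ℤ.≤ ((+ (n C b)) ℤ.- (+ ((n ∸ a + 1) C b))) ℤ.+ (+ (n ∸ a + 1))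
lemma5p2 (suc (suc k)) (suc b) n (s≤s (s≤s _)) (s≤s k<b) a+b≤n =
  m+n+o≤p+q⇒m+n≤p-o+q {m = (n ∸ 1) C suc k} {(n ∸ 1) C b} {d C suc b} {n C suc b} {d}
    (subst (λ N → (N ∸ 1) C suc k + (N ∸ 1) C b + d C suc b ≤ N C suc b + d) n≡1+k+d
      (lemma5p2-shifted k b d k<b b+2≤d))
  where
  a = suc (suc k)
  d = n ∸ a + 1
  b+2≤d : suc (suc b) ≤ d
  b+2≤d = subst (_≤ d) (+-comm (suc b) 1)
    (+-monoˡ-≤ 1 (m+n≤o⇒m≤o∸n (suc b) (subst (_≤ n) (+-comm a (suc b)) a+b≤n)))
  n≡1+k+d : suc (k + d) ≡ n
  n≡1+k+d = trans (shift k (n ∸ a)) (m∸n+n≡m (m+n≤o⇒m≤o a a+b≤n))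
    where
    shift : ∀ k x → suc (k + (x + 1)) ≡ x + suc (suc k)
    shift = solve-∀
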